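{- Let $G=(V,E)$ be a graph, $x\in\mathbb{R}^E_{\ge0}$, $\eta>0$, and $S\subseteq V$. Let $S_1,\dots,S_r$ be pairwise disjoint subsets of $S$, each of which is $\eta$-well-connected. Let $G_S=(V_S,E_S)$ be the graph obtained from $G[S]$ by contracting each of $S_1,\dots,S_r$ (so $E_S$ consists of the edges of $G[S]$ not having both endpoints in the same $S_i$). Then $S$ is $\eta$-well-connected (i.e. $\eta\, x_{\mid E(S)}\in P_{\mathrm{st}}^{\uparrow}(G[S])$) if and only if $\eta\, x_{\mid E_S}\in P_{\mathrm{st}}^{\uparrow}(G_S)$.
   Context: For $S\subseteq V$, $G[S]$ is the induced subgraph and $E(S)$ its edge set. For a graph $H=(W,F)$ and a partition $\mathcal{P}$ of $W$, $\delta_H(\mathcal{P})$ denotes the set of edges of $H$ whose endpoints lie in different parts of $\mathcal{P}$. The spanning tree polytope of $H$ is $P_{\mathrm{st}}(H)=\{y\in\mathbb{R}^F_{\ge0}: y(F)=|W|-1,\ y(F(U))\le |U|-1\ \forall U\subseteq W\}$, and its dominant is $P_{\mathrm{st}}^{\uparrow}(H)=\{y: y\ge z \text{ for some } z\in P_{\mathrm{st}}(H)\}=\{y\in\mathbb{R}^F_{\ge0}: y(\delta_H(\mathcal{P}))\ge|\mathcal{P}|-1 \text{ for all partitions }\mathcal{P}\text{ of }W\}$. A set $S\subseteq V$ is $\eta$-well-connected (with respect to $x$) if $\eta\, x_{\mid E(S)}\in P_{\mathrm{st}}^{\uparrow}(G[S])$, i.e. $\eta x(\delta_{G[S]}(\mathcal{P}))-(|\mathcal{P}|-1)\ge0$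 for every partition $\mathcal{P}$ of $S$. -}

module Defs where

open import Level using (Level; _⊔_) renaming (suc to lsuc)
open import Algebra.Bundles using (CommutativeRing)
open import Relation.Binary.Structures using (IsTotalOrder)
open import Data.Nat using (ℕ; zero; suc)
open import Data.Fin using (Fin; zero; suc; _≟_)
open import Data.Fin.Subset using (Subset; _∈_)
open import Data.Fin.Subset.Properties using (_∈?_)
open import Data.Bool using (Bool; true; false; _∧_; not; if_then_else_)
open import Data.Maybe using (Maybe; just; nothing)
open import Data.Product using (Σ; _×_; _,_; proj₁; proj₂; ∃)
open import Data.Sum using (_⊎_; inj₁; inj₂)
open import Relation.Nullary using (¬_)
open import Relation.Nullary.Decidable using (⌊_⌋)
open import Relation.Binary.PropositionalEquality using (_≡_)

-- Totally ordered commutative rings (ℝ is an instance).  The paper works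
-- over ℝ; we state the result for every ordered commutative ring.

record OrderedCommRing (c ℓ₁ ℓ₂ : Level) : Set (lsuc (c ⊔ ℓ₁ ⊔ ℓ₂)) where
  field
    commutativeRing : CommutativeRing c ℓ₁
  open CommutativeRing commutativeRing public
    using (Carrier; _≈_; _+_; _*_; -_; 0#; 1#; ring; rawRing)
  infix 4 _≤_
  field
    _≤_          : Carrier → Carrier → Set ℓ₂
    isTotalOrder : IsTotalOrder _≈_ _≤_
    +-monoˡ-≤    : ∀ {a b} (z : Carrier) → a ≤ b → a + z ≤ b + z
    *-nonneg     : ∀ {a b} → 0# ≤ a → 0# ≤ b → 0# ≤ a * b

  _<_ : Carrier → Carrier → Set (ℓ₁ ⊔ ℓ₂)
  a < b = (a ≤ b) × ¬ (a ≈ b)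

  fromℕ : ℕ → Carrier
  fromℕ zero    = 0#
  fromℕ (suc k) = 1# + fromℕ k

record Graph : Set where
  field
    n    : ℕ
    m    : ℕ
    ends : Fin m → Fin n × Fin n

module _ {c ℓ₁ ℓ₂} (R : OrderedCommRing c ℓ₁ ℓ₂) where
  open OrderedCommRing R using (Carrier; _≤_; _+_; _*_; -_; 0#; 1#; fromℕ)

  sumFin : ∀ {m} → (Fin m → Carrier) → Carrier
  sumFin {zero}  f = 0#
  sumFin {suc m} f = f zero + sumFin (λ i → f (suc i))

  -- A graph H = (W, F) given abstractly: vertices are the elements of a type
  -- V lying in W, edges are the e : Fin m with inF e ≡ true, with endpoints
  -- endsH e.  A partition of W into k parts is a map p : V → Fin k all of
  -- whose k classes meet W (values outside W are irrelevant).
  IsPartition : ∀ {V : Set} (W : V → Set) {k : ℕ} → (V → Fin k) → Set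
  IsPartition {V} W {k} p = ∀ (j : Fin k) → ∃ λ (v : V) → W v × p v ≡ j

  cutWeight : ∀ {V : Set} {m k : ℕ} → (Fin m → Bool) → (Fin m → V × V) →
              (V → Fin k) → (Fin m → Carrier) → Carrier
  cutWeight inF endsH p y =
    sumFin (λ e → if inF e ∧ not ⌊ p (proj₁ (endsH e)) ≟ p (proj₂ (endsH e)) ⌋
                  then y e else 0#)

  -- y ∈ P_st^↑(H), via the partition description:
  -- y ≥ 0 and y(δ_H(P)) ≥ |P| - 1 for every partition P of W.
  InDominantST : ∀ {V : Set} {m : ℕ} (W : V → Set) (inF : Fin m → Bool)
                 (endsH : Fin m → V × V) (y : Fin m → Carrier) → Set ℓ₂
  InDominantST {V} {m} W inF endsH y =
    (∀ e → inF e ≡ true → 0# ≤ y e) ×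
    (∀ (k : ℕ) (p : V → Fin k) → IsPartition W p →
       fromℕ k + (- 1#) ≤ cutWeight inF endsH p y)

  module _ (G : Graph) where
    open Graph G

    inducedEdge : Subset n → Fin m → Bool
    inducedEdge S e = ⌊ proj₁ (ends e) ∈? S ⌋ ∧ ⌊ proj₂ (ends e) ∈? S ⌋

    scaled : Carrier → (Fin m → Carrier) → Fin m → Carrier
    scaled η x e = η * x e

    WellConnected : Carrier → (Fin m → Carrier) → Subset n → Set ℓ₂
    WellConnected η x S =
      InDominantST (λ v → v ∈ S) (inducedEdge S) ends (scaled η x)

    -- Contraction of pairwise disjoint sets Sᵢ (i : Fin r) inside G[S].
    -- block v = the (first, hence unique) i with v ∈ Sᵢ, if any.
    firstTrue : ∀ {r} → (Fin r → Bool) → Maybe (Fin r)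
    firstTrue {zero}  b = nothing
    firstTrue {suc r} b with b zero
    ... | true  = just zero
    ... | false with firstTrue (λ i → b (suc i))
    ...   | just i  = just (suc i)
    ...   | nothing = nothing

    block : ∀ {r} → (Fin r → Subset n) → Fin n → Maybe (Fin r)
    block Ss v = firstTrue (λ i → ⌊ v ∈? Ss i ⌋)

    contractMap : ∀ {r} → (Fin r → Subset n) → Fin n → Fin n ⊎ Fin r
    contractMap Ss v with block Ss v
    ... | just i  = inj₂ i
    ... | nothing = inj₁ v

    sameBlock : ∀ {r} → (Fin r → Subset n) → Fin n → Fin n → Bool
    sameBlock Ss u v with block Ss u | block Ss v
    ... | just i | just j = ⌊ i ≟ j ⌋
    ... | _      | _      = false

    contractedVertex : ∀ {r} → Subset n → (Fin r → Subset n) → Fin n ⊎ Fin r → Set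
    contractedVertex S Ss w = ∃ λ v → v ∈ S × contractMap Ss v ≡ w

    contractedEdge : ∀ {r} → Subset n → (Fin r → Subset n) → Fin m → Bool
    contractedEdge S Ss e =
      inducedEdge S e ∧ not (sameBlock Ss (proj₁ (ends e)) (proj₂ (ends e)))

    contractedEnds : ∀ {r} → (Fin r → Subset n) → Fin m → (Fin n ⊎ Fin r) × (Fin n ⊎ Fin r)
    contractedEnds Ss e = contractMap Ss (proj₁ (ends e)) , contractMap Ss (proj₂ (ends e))

    ContractedWellConnected : ∀ {r} → Carrier → (Fin m → Carrier) →
                              Subset n → (Fin r → Subset n) → Set ℓ₂
    ContractedWellConnected η x S Ss =
      InDominantST (contractedVertex S Ss) (contractedEdge S Ss)
                   (contractedEnds Ss) (scaled η x)

{-# OPTIONS --safe #-}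
-- Well-connectedness is best read on labellings p : V → Fin K rather than on partitions: it says
-- (number of classes of p met by S) − 1 ≤ cut weight of p, empty classes being harmless because
-- they can be deleted without changing the cut. A partition of the contracted graph pulls back
-- along the contraction map to a partition of S with the same cut, which gives one direction.
-- Conversely, argue by induction on the number of classes met. If p is constant on every block Sᵢ
-- it factors through the contraction and the bound comes from G_S. Otherwise some Sᵢ meets q ≥ 2
-- classes; merging them into one class leaves q − 1 fewer classes and lowers the cut by at least
-- the cut of p inside G[Sᵢ], which is ≥ q − 1 because Sᵢ is well-connected.
module Submission where

open import Defs
open import Data.Nat using (ℕ; zero; suc)
open import Data.Fin using (Fin; zero; suc; _≟_; punchIn; punchOut)
open import Data.Fin.Subset using (Subset; _⊆_; _∩_; ⊥; _∈_)
open import Data.Product using (_×_; _,_; proj₁; proj₂; ∃)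
open import Relation.Binary.PropositionalEquality
  using (_≡_; _≢_; refl; sym; trans; cong; cong₂; subst; subst₂; _≗_)
open import Function.Bundles using (_⇔_; mk⇔; Equivalence)

open import Algebra.Bundles using (CommutativeRing)
import Algebra.Properties.CommutativeMonoid.Sum as CommutativeMonoidSum
import Algebra.Properties.Ring as RingProperties
import Algebra.Solver.CommutativeMonoid as CommutativeMonoidSolver
open import Data.Bool using (Bool; true; false; _∧_; not; if_then_else_)
open import Data.Bool.Properties using (∧-conicalˡ)
import Data.Nat as ℕ
import Data.Nat.Properties as ℕ
open import Data.Nat.Induction using (<-rec)
open import Data.Fin.Properties
  using (punchInᵢ≢i; punchIn-punchOut; punchOut-cong; punchOut-injective; punchOut-punchIn; any?; all?; ¬∀⟶∃¬)
open import Data.Fin.Subset.Properties using (_∈?_)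
open import Data.Maybe using (just; nothing)
open import Data.Sum using (_⊎_; inj₁; inj₂)
open import Function using (_∘_)
open import Relation.Binary.Bundles using (Poset)
open import Relation.Binary.Structures using (IsTotalOrder)
open import Relation.Nullary using (¬_; Dec; yes; no; does; contradiction)
open import Relation.Nullary.Decidable
  using (⌊_⌋; isYes≗does; dec-true; dec-false; does-⇔; map′; _×-dec_; _⊎-dec_; ¬?)

module ℕΣ = CommutativeMonoidSum ℕ.+-0-commutativeMonoid

indicator : Bool → ℕ
indicator b = if b then 1 else 0

count : ∀ {K} → (Fin K → Bool) → ℕ
count f = ℕΣ.sum (indicator ∘ f)

count-remove : ∀ {K} (f : Fin (suc K) → Bool) (j : Fin (suc K)) →
               count f ≡ indicator (f j) ℕ.+ count (f ∘ punchIn j)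
count-remove f j = ℕΣ.sum-remove {i = j} (indicator ∘ f)

count-all : ∀ {K} {f : Fin K → Bool} → (∀ j → f j ≡ true) → count f ≡ K
count-all {zero}  all = refl
count-all {suc K} all rewrite all zero = cong suc (count-all (all ∘ suc))

count-none : ∀ {K} {f : Fin K → Bool} → (∀ j → f j ≡ false) → count f ≡ 0
count-none {K} none = trans (ℕΣ.sum-cong-≗ (cong indicator ∘ none)) (ℕΣ.sum-replicate-zero K)

count-single : ∀ {K} (c : Fin K) → count (λ j → does (j ≟ c)) ≡ 1
count-single {suc K} c = trans (count-remove (λ j → does (j ≟ c)) c)
  (cong₂ ℕ._+_ (cong indicator (dec-true (c ≟ c) refl))
               (count-none (λ j → dec-false (punchIn c j ≟ c) (punchInᵢ≢i c j))))

indicator≤count : ∀ {K} (f : Fin K → Bool) (j : Fin K) → indicator (f j) ℕ.≤ count f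
indicator≤count {suc K} f j = begin
  indicator (f j)                                   ≤⟨ ℕ.m≤m+n _ _ ⟩
  indicator (f j) ℕ.+ count (f ∘ punchIn j)          ≡⟨ count-remove f j ⟨
  count f                                           ∎
  where open ℕ.≤-Reasoning

count-two : ∀ {K} {f : Fin K → Bool} {a b} → f a ≡ true → f b ≡ true → a ≢ b → 2 ℕ.≤ count f
count-two {suc K} {f} {a} {b} fa fb a≢b = begin
  2                                                 ≡⟨ cong₂ ℕ._+_ (cong indicator fa) (cong indicator fb′) ⟨
  indicator (f a) ℕ.+ indicator (f (punchIn a b′))  ≤⟨ ℕ.+-monoʳ-≤ _ (indicator≤count (f ∘ punchIn a) b′) ⟩
  indicator (f a) ℕ.+ count (f ∘ punchIn a)         ≡⟨ count-remove f a ⟨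
  count f                                           ∎
  where
  open ℕ.≤-Reasoning
  b′ = punchOut a≢b
  fb′ : f (punchIn a b′) ≡ true
  fb′ = trans (cong f (punchIn-punchOut a≢b)) fb

count-+-pointwise : ∀ {K} {f g f′ g′ : Fin K → Bool} →
  (∀ j → indicator (f j) ℕ.+ indicator (g j) ≡ indicator (f′ j) ℕ.+ indicator (g′ j)) →
  count f ℕ.+ count g ≡ count f′ ℕ.+ count g′
count-+-pointwise {f = f} {g} {f′} {g′} eq =
  trans (sym (ℕΣ.∑-distrib-+ (indicator ∘ f) (indicator ∘ g)))
        (trans (ℕΣ.sum-cong-≗ eq) (ℕΣ.∑-distrib-+ (indicator ∘ f′) (indicator ∘ g′)))

m+k≡1+n⇒2≤k⇒m<n : ∀ {m k n} → m ℕ.+ k ≡ suc n → 2 ℕ.≤ k → m ℕ.< n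
m+k≡1+n⇒2≤k⇒m<n {m} {k} {n} eq 2≤k = ℕ.s≤s⁻¹ (begin
  suc (suc m)  ≡⟨ ℕ.+-comm 2 m ⟩
  m ℕ.+ 2      ≤⟨ ℕ.+-monoʳ-≤ m 2≤k ⟩
  m ℕ.+ k      ≡⟨ eq ⟩
  suc n        ∎)
  where open ℕ.≤-Reasoning

indicator-merged-class : ∀ {A H Q : Set} (a? : Dec A) (h? : Dec H) (q? : Dec Q) → (A → Q) → (Q → H) →
  indicator (does (a? ⊎-dec (h? ×-dec ¬? q?))) ℕ.+ indicator (does q?) ≡ indicator (does a?) ℕ.+ indicator (does h?)
indicator-merged-class (yes _) (yes _)  (yes _)  _   _   = refl
indicator-merged-class (yes a) _        (no ¬q)  A⇒Q _   = contradiction (A⇒Q a) ¬q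
indicator-merged-class _       (no ¬h)  (yes q)  _   Q⇒H = contradiction (Q⇒H q) ¬h
indicator-merged-class (no _)  (yes _)  (yes _)  _   _   = refl
indicator-merged-class (no _)  (yes _)  (no _)   _   _   = refl
indicator-merged-class (no _)  (no _)   (no _)   _   _   = refl

∧-not-absorb : ∀ b s {A : Set} (a? : Dec A) → (s ≡ true → A) → b ∧ not ⌊ a? ⌋ ≡ (b ∧ not s) ∧ not ⌊ a? ⌋
∧-not-absorb false s     a?      _   = refl
∧-not-absorb true  false a?      _   = refl
∧-not-absorb true  true  (yes _) _   = refl
∧-not-absorb true  true  (no ¬a) s⇒A = contradiction (s⇒A refl) ¬a

⌊⌋-⇔ : ∀ {A B : Set} → A ⇔ B → (a? : Dec A) (b? : Dec B) → ⌊ a? ⌋ ≡ ⌊ b? ⌋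
⌊⌋-⇔ A⇔B a? b? = trans (isYes≗does a?) (trans (does-⇔ A⇔B a? b?) (sym (isYes≗does b?)))

Meets : ∀ {V : Set} (W : V → Set) {K} → (V → Fin K) → Fin K → Set
Meets W p j = ∃ λ v → W v × p v ≡ j

meets? : ∀ {n K} (T : Subset n) (p : Fin n → Fin K) (j : Fin K) → Dec (Meets (_∈ T) p j)
meets? T p j = any? (λ v → (v ∈? T) ×-dec (p v ≟ j))

-- squeeze j deletes the class j; its value at j itself is junk.
squeeze : ∀ {K} → Fin (suc (suc K)) → Fin (suc (suc K)) → Fin (suc K)
squeeze j x with j ≟ x
... | yes _   = zero
... | no j≢x  = punchOut j≢x

squeeze-≢ : ∀ {K} {j x : Fin (suc (suc K))} (j≢x : j ≢ x) → squeeze j x ≡ punchOut j≢x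
squeeze-≢ {j = j} {x} j≢x with j ≟ x
... | yes j≡x = contradiction j≡x j≢x
... | no _    = punchOut-cong j refl

squeeze-punchIn : ∀ {K} (j : Fin (suc (suc K))) (j′ : Fin (suc K)) → squeeze j (punchIn j j′) ≡ j′
squeeze-punchIn j j′ = trans (squeeze-≢ (punchInᵢ≢i j j′ ∘ sym)) (punchOut-punchIn j)

squeeze-≡⇔ : ∀ {K} {j x x′ : Fin (suc (suc K))} → j ≢ x → j ≢ x′ → x ≡ x′ ⇔ squeeze j x ≡ squeeze j x′
squeeze-≡⇔ {j = j} j≢x j≢x′ = mk⇔ (cong (squeeze j)) λ eq →
  punchOut-injective j≢x j≢x′ (trans (sym (squeeze-≢ j≢x)) (trans eq (squeeze-≢ j≢x′)))

module _ {V : Set} {W : V → Set} {K} (p : V → Fin (suc (suc K))) {j} (j-empty : ¬ Meets W p j) where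

  empty-class-avoided : ∀ {v} → W v → j ≢ p v
  empty-class-avoided {v} v∈W j≡pv = j-empty (v , v∈W , sym j≡pv)

  meets-squeeze⇔ : ∀ j′ → Meets W p (punchIn j j′) ⇔ Meets W (squeeze j ∘ p) j′
  meets-squeeze⇔ j′ = mk⇔
    (λ (v , v∈W , pv≡) → v , v∈W , trans (cong (squeeze j) pv≡) (squeeze-punchIn j j′))
    (λ (v , v∈W , eq) → v , v∈W , trans (sym (punchIn-punchOut (empty-class-avoided v∈W)))
                                   (cong (punchIn j) (trans (sym (squeeze-≢ (empty-class-avoided v∈W))) eq)))

  meets-squeeze? : (∀ j → Dec (Meets W p j)) → ∀ j′ → Dec (Meets W (squeeze j ∘ p) j′)
  meets-squeeze? meets j′ = map′ to from (meets (punchIn j j′))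
    where open Equivalence (meets-squeeze⇔ j′)

  count-squeeze : (meets : ∀ j → Dec (Meets W p j)) →
    count (λ j → does (meets j)) ≡ count (λ j′ → does (meets-squeeze? meets j′))
  count-squeeze meets = trans (count-remove (λ j → does (meets j)) j)
    (cong (ℕ._+ count (λ j′ → does (meets-squeeze? meets j′))) (cong indicator (dec-false (meets j) j-empty)))

module _ {c ℓ₁ ℓ₂} (R : OrderedCommRing c ℓ₁ ℓ₂) where
  open OrderedCommRing R
  open CommutativeRing commutativeRing
    using (+-cong; +-assoc; +-comm; +-identityˡ; +-identityʳ; -‿inverseʳ; +-commutativeMonoid)
    renaming (refl to ≈-refl; sym to ≈-sym; trans to ≈-trans)
  open IsTotalOrder isTotalOrder using (total; isPartialOrder) renaming (reflexive to ≤-reflexive; trans to ≤-trans)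
  open CommutativeMonoidSolver +-commutativeMonoid using (solve; _⊕_; _⊜_)
  module RΣ = CommutativeMonoidSum +-commutativeMonoid

  ≤-poset : Poset c ℓ₁ ℓ₂
  ≤-poset = record { isPartialOrder = isPartialOrder }

  open import Relation.Binary.Reasoning.PartialOrder ≤-poset

  +-mono-≤ : ∀ {a a′ b b′} → a ≤ a′ → b ≤ b′ → a + b ≤ a′ + b′
  +-mono-≤ {a} {a′} {b} {b′} a≤a′ b≤b′ = begin
    a + b    ≤⟨ +-monoˡ-≤ b a≤a′ ⟩
    a′ + b   ≈⟨ +-comm a′ b ⟩
    b + a′   ≤⟨ +-monoˡ-≤ a′ b≤b′ ⟩
    b′ + a′  ≈⟨ +-comm b′ a′ ⟩
    a′ + b′  ∎

  -1≤0 : - 1# ≤ 0#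
  -1≤0 with total 0# (- 1#)
  ... | inj₂ -1≤0 = -1≤0
  ... | inj₁ 0≤-1 = begin
    - 1#       ≈⟨ +-identityˡ (- 1#) ⟨
    0# + - 1#  ≤⟨ +-monoˡ-≤ (- 1#) 0≤1 ⟩
    1# + - 1#  ≈⟨ -‿inverseʳ 1# ⟩
    0#         ∎
    where
    open RingProperties ring using (-1*x≈-x; -‿involutive)
    0≤1 : 0# ≤ 1#
    0≤1 = begin
      0#            ≤⟨ *-nonneg 0≤-1 0≤-1 ⟩
      - 1# * - 1#   ≈⟨ -1*x≈-x (- 1#) ⟩
      - (- 1#)      ≈⟨ -‿involutive 1# ⟩
      1#            ∎

  fromℕ-+ : ∀ a b → fromℕ (a ℕ.+ b) ≈ fromℕ a + fromℕ b
  fromℕ-+ zero    b = ≈-sym (+-identityˡ (fromℕ b))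
  fromℕ-+ (suc a) b = ≈-trans (+-cong ≈-refl (fromℕ-+ a b)) (≈-sym (+-assoc 1# (fromℕ a) (fromℕ b)))

  bound-0 : ∀ {w} → 0# ≤ w → fromℕ 0 + - 1# ≤ w
  bound-0 {w} 0≤w = begin
    0# + - 1#  ≈⟨ +-identityˡ (- 1#) ⟩
    - 1#       ≤⟨ -1≤0 ⟩
    0#         ≤⟨ 0≤w ⟩
    w          ∎

  bound-+ : ∀ a b {h w z} → a ℕ.+ b ≡ suc h →
            fromℕ a + - 1# ≤ w → fromℕ b + - 1# ≤ z → fromℕ h + - 1# ≤ w + z
  bound-+ a b {h} {w} {z} a+b≡1+h a≤w b≤z = begin
    fromℕ h + - 1#                          ≈⟨ +-identityʳ _ ⟨
    (fromℕ h + - 1#) + 0#                   ≈⟨ +-cong ≈-refl (-‿inverseʳ 1#) ⟨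
    (fromℕ h + - 1#) + (1# + - 1#)          ≈⟨ solve 3 (λ H o m → (H ⊕ m) ⊕ (o ⊕ m) ⊜ (o ⊕ H) ⊕ (m ⊕ m)) ≈-refl
                                                 (fromℕ h) 1# (- 1#) ⟩
    fromℕ (suc h) + (- 1# + - 1#)           ≡⟨ cong (λ k → fromℕ k + (- 1# + - 1#)) a+b≡1+h ⟨
    fromℕ (a ℕ.+ b) + (- 1# + - 1#)         ≈⟨ +-cong (fromℕ-+ a b) ≈-refl ⟩
    (fromℕ a + fromℕ b) + (- 1# + - 1#)     ≈⟨ solve 3 (λ A B m → (A ⊕ B) ⊕ (m ⊕ m) ⊜ (A ⊕ m) ⊕ (B ⊕ m)) ≈-refl
                                                 (fromℕ a) (fromℕ b) (- 1#) ⟩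
    (fromℕ a + - 1#) + (fromℕ b + - 1#)     ≤⟨ +-mono-≤ a≤w b≤z ⟩
    w + z                                   ∎

  sumFin≡sum : ∀ {m} (f : Fin m → Carrier) → sumFin R f ≡ RΣ.sum f
  sumFin≡sum {zero}  f = refl
  sumFin≡sum {suc m} f = cong (f zero +_) (sumFin≡sum (f ∘ suc))

  sumFin-cong : ∀ {m} {f g : Fin m → Carrier} → f ≗ g → sumFin R f ≡ sumFin R g
  sumFin-cong {f = f} {g} f≗g = trans (sumFin≡sum f) (trans (RΣ.sum-cong-≗ f≗g) (sym (sumFin≡sum g)))

  sumFin-distrib-+ : ∀ {m} (f g : Fin m → Carrier) → sumFin R (λ e → f e + g e) ≈ sumFin R f + sumFin R g
  sumFin-distrib-+ f g rewrite sumFin≡sum (λ e → f e + g e) | sumFin≡sum f | sumFin≡sum g = RΣ.∑-distrib-+ f g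

  sumFin-mono-≤ : ∀ {m} {f g : Fin m → Carrier} → (∀ e → f e ≤ g e) → sumFin R f ≤ sumFin R g
  sumFin-mono-≤ {zero}  _   = ≤-reflexive ≈-refl
  sumFin-mono-≤ {suc m} f≤g = +-mono-≤ (f≤g zero) (sumFin-mono-≤ (f≤g ∘ suc))

  sumFin-nonneg : ∀ {m} {f : Fin m → Carrier} → (∀ e → 0# ≤ f e) → 0# ≤ sumFin R f
  sumFin-nonneg {zero}  _   = ≤-reflexive ≈-refl
  sumFin-nonneg {suc m} 0≤f = begin
    0#       ≈⟨ +-identityˡ 0# ⟨
    0# + 0#  ≤⟨ +-mono-≤ (0≤f zero) (sumFin-nonneg (0≤f ∘ suc)) ⟩
    _        ∎

  cutTerm : ∀ {V : Set} {m k} → (Fin m → Bool) → (Fin m → V × V) → (V → Fin k) → (Fin m → Carrier) →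
            Fin m → Carrier
  cutTerm inF endsH p y e = if inF e ∧ not ⌊ p (proj₁ (endsH e)) ≟ p (proj₂ (endsH e)) ⌋ then y e else 0#

  module _ {V : Set} {m} {inF : Fin m → Bool} {endsH : Fin m → V × V} {y : Fin m → Carrier} where

    cut-nonneg : ∀ {k} (p : V → Fin k) → (∀ e → inF e ≡ true → 0# ≤ y e) → 0# ≤ cutWeight R inF endsH p y
    cut-nonneg p 0≤y = sumFin-nonneg term
      where
      term : ∀ e → 0# ≤ cutTerm inF endsH p y e
      term e with inF e in e∈F | p (proj₁ (endsH e)) ≟ p (proj₂ (endsH e))
      ... | false | _     = ≤-reflexive ≈-refl
      ... | true  | yes _ = ≤-reflexive ≈-refl
      ... | true  | no _  = 0≤y e e∈F

    cut-cong : ∀ {k k′} (p : V → Fin k) (p′ : V → Fin k′) →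
      (∀ e → inF e ≡ true →
             p (proj₁ (endsH e)) ≡ p (proj₂ (endsH e)) ⇔ p′ (proj₁ (endsH e)) ≡ p′ (proj₂ (endsH e))) →
      cutWeight R inF endsH p y ≡ cutWeight R inF endsH p′ y
    cut-cong p p′ same = sumFin-cong term
      where
      term : ∀ e → cutTerm inF endsH p y e ≡ cutTerm inF endsH p′ y e
      term e with inF e in e∈F
      ... | false = refl
      ... | true  = cong (λ b → if not b then y e else 0#) (⌊⌋-⇔ (same e e∈F) (_ ≟ _) (_ ≟ _))

    cut-≗ : ∀ {k} {p p′ : V → Fin k} → p ≗ p′ → cutWeight R inF endsH p y ≡ cutWeight R inF endsH p′ y
    cut-≗ {p = p} {p′} p≗p′ = cut-cong p p′ λ e _ →
      mk⇔ (λ eq → trans (sym (p≗p′ _)) (trans eq (p≗p′ _))) (λ eq → trans (p≗p′ _) (trans eq (sym (p≗p′ _))))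

  cutTerm-split : ∀ (s s′ : Bool) {A B : Set} (a? : Dec A) (b? : Dec B) {Y} → (s ≡ true → 0# ≤ Y) →
    (s′ ≡ true → s ≡ true) → (s′ ≡ true → B) → (A → B) →
    (if s ∧ not ⌊ b? ⌋ then Y else 0#) + (if s′ ∧ not ⌊ a? ⌋ then Y else 0#) ≤ (if s ∧ not ⌊ a? ⌋ then Y else 0#)
  cutTerm-split s     true  a?      (yes _)  _   s′⇒s _   _   rewrite s′⇒s refl = ≤-reflexive (+-identityˡ _)
  cutTerm-split s     true  a?      (no ¬b)  _   _    s′⇒b _   = contradiction (s′⇒b refl) ¬b
  cutTerm-split false false a?      b?       _   _    _    _   = ≤-reflexive (+-identityˡ 0#)
  cutTerm-split true  false (yes _) (yes _)  _   _    _    _   = ≤-reflexive (+-identityˡ 0#)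
  cutTerm-split true  false (yes a) (no ¬b)  _   _    _    A⇒B = contradiction (A⇒B a) ¬b
  cutTerm-split true  false (no _)  (yes _)  0≤Y _    _    _   = ≤-trans (≤-reflexive (+-identityˡ 0#)) (0≤Y refl)
  cutTerm-split true  false (no _)  (no _)   _   _    _    _   = ≤-reflexive (+-identityʳ _)

  -- f ∘ p cuts no edge of F′, so no edge is counted twice on the left.
  cut-coarsen-split : ∀ {V : Set} {m k k′} {inF inF′ : Fin m → Bool} {endsH : Fin m → V × V} {y : Fin m → Carrier}
    (p : V → Fin k) (f : Fin k → Fin k′) → (∀ e → inF e ≡ true → 0# ≤ y e) →
    (∀ e → inF′ e ≡ true → inF e ≡ true) →
    (∀ e → inF′ e ≡ true → f (p (proj₁ (endsH e))) ≡ f (p (proj₂ (endsH e)))) →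
    cutWeight R inF endsH (f ∘ p) y + cutWeight R inF′ endsH p y ≤ cutWeight R inF endsH p y
  cut-coarsen-split {inF = inF} {inF′} {endsH} {y} p f 0≤y F′⊆F F′-merged = begin
    sumFin R (cutTerm inF endsH (f ∘ p) y) + sumFin R (cutTerm inF′ endsH p y)
      ≈⟨ sumFin-distrib-+ (cutTerm inF endsH (f ∘ p) y) (cutTerm inF′ endsH p y) ⟨
    sumFin R (λ e → cutTerm inF endsH (f ∘ p) y e + cutTerm inF′ endsH p y e)
      ≤⟨ sumFin-mono-≤ term ⟩
    sumFin R (cutTerm inF endsH p y) ∎
    where
    term : ∀ e → cutTerm inF endsH (f ∘ p) y e + cutTerm inF′ endsH p y e ≤ cutTerm inF endsH p y e
    term e = cutTerm-split (inF e) (inF′ e) (_ ≟ _) (_ ≟ _) (0≤y e) (F′⊆F e) (F′-merged e) (cong f)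

  InDominantST⇒labellingBound :
    ∀ {V : Set} {W : V → Set} {m} {inF : Fin m → Bool} {endsH : Fin m → V × V} {y : Fin m → Carrier} →
    InDominantST R W inF endsH y →
    (∀ e → inF e ≡ true → W (proj₁ (endsH e)) × W (proj₂ (endsH e))) →
    ∀ {K} (p : V → Fin K) (meets : ∀ j → Dec (Meets W p j)) →
    fromℕ (count (λ j → does (meets j))) + - 1# ≤ cutWeight R inF endsH p y
  InDominantST⇒labellingBound dom endsW {K} p meets with all? meets
  ... | yes all = subst (λ k → fromℕ k + - 1# ≤ _) (sym (count-all (λ j → dec-true (meets j) (all j))))
                        (proj₂ dom K p all)
  ... | no ¬all with ¬∀⟶∃¬ K _ meets ¬all
  InDominantST⇒labellingBound {inF = inF} {endsH} {y} dom endsW {suc zero} p meets | no _ | zero , empty =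
    subst (λ k → fromℕ k + - 1# ≤ cutWeight R inF endsH p y)
          (sym (count-none {f = λ j → does (meets j)} λ { zero → dec-false (meets zero) empty }))
          (bound-0 (cut-nonneg p (proj₁ dom)))
  InDominantST⇒labellingBound {inF = inF} {endsH} {y} dom endsW {suc (suc K)} p meets | no _ | j , j-empty =
    subst₂ (λ k w → fromℕ k + - 1# ≤ w) (sym (count-squeeze p j-empty meets)) (sym cut-squeeze)
           (InDominantST⇒labellingBound dom endsW (squeeze j ∘ p) (meets-squeeze? p j-empty meets))
    where
    cut-squeeze : cutWeight R inF endsH p y ≡ cutWeight R inF endsH (squeeze j ∘ p) y
    cut-squeeze = cut-cong p (squeeze j ∘ p) λ e e∈F →
      squeeze-≡⇔ (empty-class-avoided p j-empty (proj₁ (endsW e e∈F)))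
                 (empty-class-avoided p j-empty (proj₂ (endsW e e∈F)))

  module _ (G : Graph) where
    open Graph G

    inducedEdge-ends : ∀ {S} e → inducedEdge R G S e ≡ true → proj₁ (ends e) ∈ S × proj₂ (ends e) ∈ S
    inducedEdge-ends {S} e eq with proj₁ (ends e) ∈? S | proj₂ (ends e) ∈? S
    inducedEdge-ends e refl | yes a∈S | yes b∈S = a∈S , b∈S
    inducedEdge-ends e ()   | yes _   | no _
    inducedEdge-ends e ()   | no _    | _

    inducedEdge-mono : ∀ {S′ S} → S′ ⊆ S → ∀ e → inducedEdge R G S′ e ≡ true → inducedEdge R G S e ≡ true
    inducedEdge-mono {S = S} S′⊆S e eq with inducedEdge-ends e eq | proj₁ (ends e) ∈? S | proj₂ (ends e) ∈? S
    ... | _         | yes _   | yes _   = refl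
    ... | a∈S′ , _  | no a∉S  | _       = contradiction (S′⊆S a∈S′) a∉S
    ... | _ , b∈S′  | yes _   | no b∉S  = contradiction (S′⊆S b∈S′) b∉S

    firstTrue-just : ∀ {r} (b : Fin r → Bool) {i} → firstTrue R G b ≡ just i → b i ≡ true
    firstTrue-just {suc r} b eq with b zero in b₀
    firstTrue-just {suc r} b refl | true = b₀
    firstTrue-just {suc r} b eq   | false with firstTrue R G (b ∘ suc) in rest
    firstTrue-just {suc r} b refl | false | just i = firstTrue-just (b ∘ suc) rest

    block-just : ∀ {r} {Ss : Fin r → Subset n} {v i} → block R G Ss v ≡ just i → v ∈ Ss i
    block-just {Ss = Ss} {v} {i} eq with v ∈? Ss i | firstTrue-just (λ i → ⌊ v ∈? Ss i ⌋) eq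
    ... | yes v∈ | _  = v∈
    ... | no _   | ()

    sameBlock⇒contractMap≡ : ∀ {r} (Ss : Fin r → Subset n) u v →
      sameBlock R G Ss u v ≡ true → contractMap R G Ss u ≡ contractMap R G Ss v
    sameBlock⇒contractMap≡ Ss u v eq with block R G Ss u | block R G Ss v
    ... | just i | just j with i ≟ j
    ...   | yes refl = refl
    sameBlock⇒contractMap≡ Ss u v () | just i  | just j | no _
    sameBlock⇒contractMap≡ Ss u v () | just i  | nothing
    sameBlock⇒contractMap≡ Ss u v () | nothing | _

    module _ (η : Carrier) (x : Fin m → Carrier) (0≤ηx : ∀ e → 0# ≤ scaled R G η x e) where

      cut : ∀ {K} → Subset n → (Fin n → Fin K) → Carrier
      cut T p = cutWeight R (inducedEdge R G T) ends p (scaled R G η x)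

      classes : ∀ {K} → Subset n → (Fin n → Fin K) → ℕ
      classes T p = count (λ j → does (meets? T p j))

      LabellingBound : ∀ {K} → Subset n → (Fin n → Fin K) → Set ℓ₂
      LabellingBound T p = fromℕ (classes T p) + - 1# ≤ cut T p

      wellConnected⇒labellingBound : ∀ {T} → WellConnected R G η x T → ∀ {K} (p : Fin n → Fin K) → LabellingBound T p
      wellConnected⇒labellingBound {T} wc p = InDominantST⇒labellingBound wc inducedEdge-ends p (meets? T p)

      labellingBound⇒wellConnected : ∀ {T} → (∀ {K} (p : Fin n → Fin K) → LabellingBound T p) → WellConnected R G η x T
      labellingBound⇒wellConnected {T} bound = (λ e _ → 0≤ηx e) , λ k p partition →
        subst (λ k → fromℕ k + - 1# ≤ cut T p) (count-all (λ j → dec-true (meets? T p j) (partition j))) (bound p)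

      2≤classes : ∀ {T K} {p : Fin n → Fin K} {u v} → u ∈ T → v ∈ T → p u ≢ p v → 2 ℕ.≤ classes T p
      2≤classes {T} {p = p} {u} {v} u∈T v∈T pu≢pv =
        count-two (dec-true (meets? T p (p u)) (u , u∈T , refl)) (dec-true (meets? T p (p v)) (v , v∈T , refl)) pu≢pv

      module _ (S : Subset n) {r} (Ss : Fin r → Subset n) where

        cut-contract : ∀ {K} (q : Fin n ⊎ Fin r → Fin K) →
          cut S (q ∘ contractMap R G Ss) ≡ cutWeight R (contractedEdge R G S Ss) (contractedEnds R G Ss) q (scaled R G η x)
        cut-contract q = sumFin-cong λ e →
          cong (λ b → if b then scaled R G η x e else 0#)
               (∧-not-absorb (inducedEdge R G S e) _ (_ ≟ _) (cong q ∘ sameBlock⇒contractMap≡ Ss _ _))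

        contractedEdge-ends : ∀ e → contractedEdge R G S Ss e ≡ true →
          contractedVertex R G S Ss (proj₁ (contractedEnds R G Ss e)) ×
          contractedVertex R G S Ss (proj₂ (contractedEnds R G Ss e))
        contractedEdge-ends e eq with inducedEdge-ends e (∧-conicalˡ _ _ eq)
        ... | a∈S , b∈S = (_ , a∈S , refl) , (_ , b∈S , refl)

        wellConnected⇒contracted : WellConnected R G η x S → ContractedWellConnected R G η x S Ss
        wellConnected⇒contracted (_ , bound) = (λ e _ → 0≤ηx e) , λ k q partition →
          subst (fromℕ k + - 1# ≤_) (cut-contract q) (bound k (q ∘ contractMap R G Ss) (pullback ∘ partition))
          where
          pullback : ∀ {k} {q : Fin n ⊎ Fin r → Fin k} {j} →
            Meets (contractedVertex R G S Ss) q j → Meets (_∈ S) (q ∘ contractMap R G Ss) j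
          pullback {q = q} (_ , (v , v∈S , refl) , qw≡j) = v , v∈S , qw≡j

        ConstantOnBlocks : ∀ {K} → (Fin n → Fin K) → Set
        ConstantOnBlocks p = ∀ i {u v} → u ∈ Ss i → v ∈ Ss i → p u ≡ p v

        factor : ∀ {K} → (Fin n → Fin (suc K)) → Fin n ⊎ Fin r → Fin (suc K)
        factor p (inj₁ v) = p v
        factor p (inj₂ i) with any? (_∈? Ss i)
        ... | yes (w , _) = p w
        ... | no _        = zero

        factor-contractMap : ∀ {K} {p : Fin n → Fin (suc K)} → ConstantOnBlocks p →
                             ∀ v → factor p (contractMap R G Ss v) ≡ p v
        factor-contractMap const v with block R G Ss v in v∈block
        ... | nothing = refl
        ... | just i with any? (_∈? Ss i)
        ...   | yes (w , w∈Sᵢ) = const i w∈Sᵢ (block-just v∈block)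
        ...   | no Sᵢ-empty    = contradiction (v , block-just v∈block) Sᵢ-empty

        contracted⇒labellingBound-constantOnBlocks : ContractedWellConnected R G η x S Ss →
          ∀ {K} (p : Fin n → Fin K) → ConstantOnBlocks p → LabellingBound S p
        contracted⇒labellingBound-constantOnBlocks _  {zero}  p _     = bound-0 (cut-nonneg p (λ e _ → 0≤ηx e))
        contracted⇒labellingBound-constantOnBlocks CW {suc K} p const =
          subst (fromℕ (classes S p) + - 1# ≤_) cut-factor
                (InDominantST⇒labellingBound CW contractedEdge-ends (factor p) meets-factor?)
          where
          meets-factor? : ∀ j → Dec (Meets (contractedVertex R G S Ss) (factor p) j)
          meets-factor? j = map′
            (λ (v , v∈S , pv≡j) → contractMap R G Ss v , (v , v∈S , refl) , trans (factor-contractMap const v) pv≡j)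
            (λ (_ , (v , v∈S , v↦w) , eq) →
               v , v∈S , trans (sym (factor-contractMap const v)) (trans (cong (factor p) v↦w) eq))
            (meets? S p j)
          cut-factor : cutWeight R (contractedEdge R G S Ss) (contractedEnds R G Ss) (factor p) (scaled R G η x) ≡ cut S p
          cut-factor = trans (sym (cut-contract (factor p)))
                             (cut-≗ {inF = inducedEdge R G S} {ends} {scaled R G η x} (factor-contractMap const))

        module MergeBlock (Ss⊆S : ∀ i → Ss i ⊆ S) {K} (p : Fin n → Fin K) (i : Fin r) {u} (u∈Sᵢ : u ∈ Ss i) where

          mergeBlock : Fin K → Fin K
          mergeBlock j with meets? (Ss i) p j
          ... | yes _ = p u
          ... | no _  = j

          mergeBlock-met : ∀ {j} → Meets (_∈ Ss i) p j → mergeBlock j ≡ p u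
          mergeBlock-met {j} met with meets? (Ss i) p j
          ... | yes _  = refl
          ... | no ¬met = contradiction met ¬met

          mergeBlock-unmet : ∀ {j} → ¬ Meets (_∈ Ss i) p j → mergeBlock j ≡ j
          mergeBlock-unmet {j} ¬met with meets? (Ss i) p j
          ... | yes met = contradiction met ¬met
          ... | no _    = refl

          meets-mergeBlock⇔ : ∀ j → Meets (_∈ S) (mergeBlock ∘ p) j ⇔
                                    (j ≡ p u ⊎ (Meets (_∈ S) p j × ¬ Meets (_∈ Ss i) p j))
          meets-mergeBlock⇔ j = mk⇔ to from
            where
            to : Meets (_∈ S) (mergeBlock ∘ p) j → j ≡ p u ⊎ (Meets (_∈ S) p j × ¬ Meets (_∈ Ss i) p j)
            to (w , w∈S , eq) = by-cases (meets? (Ss i) p (p w))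
              where
              by-cases : Dec (Meets (_∈ Ss i) p (p w)) → j ≡ p u ⊎ (Meets (_∈ S) p j × ¬ Meets (_∈ Ss i) p j)
              by-cases (yes met) = inj₁ (trans (sym eq) (mergeBlock-met met))
              by-cases (no ¬met) = inj₂ ((w , w∈S , pw≡j) , λ met → ¬met (subst (Meets (_∈ Ss i) p) (sym pw≡j) met))
                where
                pw≡j : p w ≡ j
                pw≡j = trans (sym (mergeBlock-unmet ¬met)) eq
            from : j ≡ p u ⊎ (Meets (_∈ S) p j × ¬ Meets (_∈ Ss i) p j) → Meets (_∈ S) (mergeBlock ∘ p) j
            from (inj₁ j≡pu) = u , Ss⊆S i u∈Sᵢ , trans (mergeBlock-met (u , u∈Sᵢ , refl)) (sym j≡pu)
            from (inj₂ ((w , w∈S , pw≡j) , ¬met)) =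
              w , w∈S , trans (mergeBlock-unmet (¬met ∘ subst (Meets (_∈ Ss i) p) pw≡j)) pw≡j

          classes-mergeBlock : classes S (mergeBlock ∘ p) ℕ.+ classes (Ss i) p ≡ suc (classes S p)
          classes-mergeBlock =
            trans (count-+-pointwise pointwise) (cong (ℕ._+ classes S p) (count-single (p u)))
            where
            pointwise : ∀ j → indicator (does (meets? S (mergeBlock ∘ p) j)) ℕ.+ indicator (does (meets? (Ss i) p j))
                            ≡ indicator (does (j ≟ p u)) ℕ.+ indicator (does (meets? S p j))
            pointwise j = trans
              (cong (λ b → indicator b ℕ.+ _)
                    (does-⇔ (meets-mergeBlock⇔ j) (meets? S (mergeBlock ∘ p) j)
                            ((j ≟ p u) ⊎-dec (meets? S p j ×-dec ¬? (meets? (Ss i) p j)))))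
              (indicator-merged-class (j ≟ p u) (meets? S p j) (meets? (Ss i) p j)
                 (λ j≡pu → u , u∈Sᵢ , sym j≡pu) (λ (w , w∈Sᵢ , pw≡j) → w , Ss⊆S i w∈Sᵢ , pw≡j))

          cut-mergeBlock : cut S (mergeBlock ∘ p) + cut (Ss i) p ≤ cut S p
          cut-mergeBlock = cut-coarsen-split p mergeBlock (λ e _ → 0≤ηx e) (inducedEdge-mono (Ss⊆S i)) λ e e∈Eᵢ →
            let a∈Sᵢ , b∈Sᵢ = inducedEdge-ends e e∈Eᵢ in
            trans (mergeBlock-met (_ , a∈Sᵢ , refl)) (sym (mergeBlock-met (_ , b∈Sᵢ , refl)))

        Splits : ∀ {K} → (Fin n → Fin K) → Set
        Splits p = ∃ λ i → ∃ λ u → ∃ λ v → u ∈ Ss i × v ∈ Ss i × p u ≢ p v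

        splits? : ∀ {K} (p : Fin n → Fin K) → Dec (Splits p)
        splits? p = any? λ i → any? λ u → any? λ v → (u ∈? Ss i) ×-dec ((v ∈? Ss i) ×-dec ¬? (p u ≟ p v))

        ¬splits⇒constantOnBlocks : ∀ {K} {p : Fin n → Fin K} → ¬ Splits p → ConstantOnBlocks p
        ¬splits⇒constantOnBlocks {p = p} ¬split i {u} {v} u∈Sᵢ v∈Sᵢ with p u ≟ p v
        ... | yes pu≡pv = pu≡pv
        ... | no pu≢pv  = contradiction (i , u , v , u∈Sᵢ , v∈Sᵢ , pu≢pv) ¬split

        contracted⇒wellConnected : (∀ i → Ss i ⊆ S) → (∀ i → WellConnected R G η x (Ss i)) →
          ContractedWellConnected R G η x S Ss → WellConnected R G η x S
        contracted⇒wellConnected Ss⊆S wcᵢ CW = labellingBound⇒wellConnected (λ p → <-rec P step _ p refl)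
          where
          P : ℕ → Set ℓ₂
          P h = ∀ {K} (p : Fin n → Fin K) → classes S p ≡ h → LabellingBound S p
          step : ∀ h → (∀ {h′} → h′ ℕ.< h → P h′) → P h
          step _ rec p refl with splits? p
          ... | no ¬split = contracted⇒labellingBound-constantOnBlocks CW p (¬splits⇒constantOnBlocks ¬split)
          ... | yes (i , u , v , u∈Sᵢ , v∈Sᵢ , pu≢pv) =
            ≤-trans (bound-+ (classes S (mergeBlock ∘ p)) (classes (Ss i) p) classes-mergeBlock
                             merged-bound (wellConnected⇒labellingBound (wcᵢ i) p))
                    cut-mergeBlock
            where
            open MergeBlock Ss⊆S p i u∈Sᵢ
            merged-bound : LabellingBound S (mergeBlock ∘ p)
            merged-bound = rec (m+k≡1+n⇒2≤k⇒m<n classes-mergeBlock (2≤classes u∈Sᵢ v∈Sᵢ pu≢pv))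
                               (mergeBlock ∘ p) refl

mainTheorem6 : ∀ {c ℓ₁ ℓ₂} (R : OrderedCommRing c ℓ₁ ℓ₂) → let open OrderedCommRing R in
    (G : Graph) → let open Graph G in
    (x : Fin m → Carrier) → (∀ e → 0# ≤ x e) →
    (η : Carrier) → 0# < η →
    (S : Subset n) → (r : ℕ) → (Ss : Fin r → Subset n) →
    (∀ i → Ss i ⊆ S) →
    (∀ i j → i ≢ j → Ss i ∩ Ss j ≡ ⊥) →
    (∀ i → WellConnected R G η x (Ss i)) →
    WellConnected R G η x S ⇔ ContractedWellConnected R G η x S Ss
mainTheorem6 R G x 0≤x η 0<η S r Ss Ss⊆S _ wcᵢ =
  mk⇔ (wellConnected⇒contracted R G η x 0≤ηx S Ss) (contracted⇒wellConnected R G η x 0≤ηx S Ss Ss⊆S wcᵢ)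
  where
  open OrderedCommRing R using (_≤_; 0#; *-nonneg)
  0≤ηx : ∀ e → 0# ≤ scaled R G η x e
  0≤ηx e = *-nonneg (proj₁ 0<η) (0≤x e)
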